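{- If $G$ is a triangle-free cubic graph, then $\mathrm{cl}(G)\simeq G$.
   Context: Graphs are finite and simple. A claw in a graph $G$ is an induced subgraph of $G$ isomorphic to $K_{1,3}$. The claw graph $\mathrm{cl}(G)$ is the graph whose vertices are the claws in $G$, where two vertices are adjacent if and only if they are distinct claws sharing a common edge. A cubic graph is a 3-regular graph; triangle-free means containing no subgraph isomorphic to $C_3$. -}

module Defs where

open import Data.Nat using (ℕ)
open import Data.Bool using (Bool; true; false; T)
open import Data.Fin using (Fin)
open import Data.Fin.Subset using (Subset; ⁅_⁆; _∪_; _∈_; ∣_∣)
open import Data.Vec using (tabulate)
open import Data.Product using (Σ; ∃; _×_)
open import Data.Empty using (⊥)
open import Relation.Nullary using (¬_)
open import Relation.Binary.PropositionalEquality using (_≡_; _≢_)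
open import Function.Bundles using (_⤖_; _⇔_)

record Graph (n : ℕ) : Set where
  field
    adj     : Fin n → Fin n → Bool
    adj-sym : ∀ u v → adj u v ≡ adj v u
    irrefl  : ∀ v → adj v v ≡ false
open Graph public

module _ {n : ℕ} (G : Graph n) where

  N : Fin n → Subset n
  N v = tabulate (adj G v)

  degree : Fin n → ℕ
  degree v = ∣ N v ∣

  Cubic : Set
  Cubic = ∀ v → degree v ≡ 3

  TriangleFree : Set
  TriangleFree = ∀ a b c → T (adj G a b) → T (adj G b c) → T (adj G a c) → ⊥

  IsClaw : Subset n → Set
  IsClaw S = Σ (Fin n) λ c → Σ (Fin n) λ a → Σ (Fin n) λ b → Σ (Fin n) λ d →
    (S ≡ ⁅ c ⁆ ∪ (⁅ a ⁆ ∪ (⁅ b ⁆ ∪ ⁅ d ⁆))) ×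
    (a ≢ b) × (a ≢ d) × (b ≢ d) ×
    (adj G c a ≡ true) × (adj G c b ≡ true) × (adj G c d ≡ true) ×
    (adj G a b ≡ false) × (adj G a d ≡ false) × (adj G b d ≡ false)

  -- A claw of G: an induced subgraph isomorphic to K_{1,3}; being induced, it is
  -- determined by its vertex set. The witness is irrelevant, so claws with the
  -- same vertex set are equal.
  record Claw : Set where
    constructor claw
    field
      verts    : Subset n
      .isClaw  : IsClaw verts
  open Claw public

  EdgeIn : Fin n → Fin n → Claw → Set
  EdgeIn u v x = T (adj G u v) × u ∈ verts x × v ∈ verts x

  ClAdj : Claw → Claw → Set
  ClAdj x y = (x ≢ y) × ∃ λ u → ∃ λ v → EdgeIn u v x × EdgeIn u v y

  ClawGraphIsoToG : Set
  ClawGraphIsoToG = Σ (Claw ⤖ Fin n) λ f →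
    ∀ x y → ClAdj x y ⇔ T (adj G (Function.Bundles.Bijection.to f x) (Function.Bundles.Bijection.to f y))

{-# OPTIONS --safe #-}

-- In a cubic graph the three leaves of a claw are all the neighbours of its
-- centre, so every claw is the closed neighbourhood N[c] of its centre c;
-- conversely, when G is triangle-free each N[c] is a claw, and N[c] determines
-- c. Hence c ↦ N[c] is a bijection from vertices to claws. By
-- triangle-freeness every edge inside N[c] passes through c, so an edge shared
-- by N[c] and N[c'] with c ≠ c' can only be cc'.
module Submission where

open import Defs
open import Data.Nat using (ℕ; suc)
open import Data.Nat.Properties using (suc-injective)
open import Data.Bool using (true; false; T)
open import Data.Bool.Properties using (T-≡; ¬-not) renaming (_≟_ to _≟ᵇ_)
open import Data.Fin using (Fin; zero; suc; _≟_)
open import Data.Fin.Properties using (any?)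
open import Data.Fin.Subset using (Subset; ⁅_⁆; _∪_; _∈_; _∉_; _⊆_; _-_; ∣_∣; Nonempty; inside; outside)
open import Data.Fin.Subset.Properties
  using (x∈⁅x⁆; x∈⁅y⁆⇒x≡y; x∈p∪q⁻; x∈p∪q⁺; ⊆-antisym; p─⊥≡p; p─q⊆p; x∈p∧x≢y⇒x∈p-y)
open import Data.Vec using (_∷_; here; there)
open import Data.Vec.Properties using (≡-dec; []=⇒lookup; lookup⇒[]=; lookup∘tabulate)
open import Data.Product using (∃-syntax; _×_; _,_; proj₁; proj₂)
open import Data.Sum using (_⊎_; inj₁; inj₂; [_,_]; map₂)
open import Data.Empty using (⊥-elim)
open import Function using (_∘_)
open import Function.Bundles using (_⇔_; mk⇔; mk⤖; Equivalence)
open import Function.Definitions using (Injective; Surjective)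
open import Relation.Nullary using (yes; no)
open import Relation.Nullary.Decidable using (recompute)
open import Relation.Binary.PropositionalEquality using (_≡_; _≢_; refl; sym; trans; cong; subst)

module _ {n : ℕ} where

  ⁅_·_·_⁆ : Fin n → Fin n → Fin n → Subset n
  ⁅ a · b · d ⁆ = ⁅ a ⁆ ∪ (⁅ b ⁆ ∪ ⁅ d ⁆)

  Distinct₃ : Fin n → Fin n → Fin n → Set
  Distinct₃ a b d = a ≢ b × a ≢ d × b ≢ d

  x∈⁅y⁆∪p⁻ : ∀ {x y} (p : Subset n) → x ∈ ⁅ y ⁆ ∪ p → x ≡ y ⊎ x ∈ p
  x∈⁅y⁆∪p⁻ {y = y} p x∈ with x∈p∪q⁻ ⁅ y ⁆ p x∈
  ... | inj₁ x∈⁅y⁆ = inj₁ (x∈⁅y⁆⇒x≡y y x∈⁅y⁆)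
  ... | inj₂ x∈p   = inj₂ x∈p

  x∈⁅y⁆∪p⁺ : ∀ {x y} {p : Subset n} → x ≡ y ⊎ x ∈ p → x ∈ ⁅ y ⁆ ∪ p
  x∈⁅y⁆∪p⁺ {x} (inj₁ refl) = x∈p∪q⁺ (inj₁ (x∈⁅x⁆ x))
  x∈⁅y⁆∪p⁺     (inj₂ x∈p)  = x∈p∪q⁺ (inj₂ x∈p)

  x∈⁅a·b·d⁆⁻ : ∀ {x a b d} → x ∈ ⁅ a · b · d ⁆ → x ≡ a ⊎ x ≡ b ⊎ x ≡ d
  x∈⁅a·b·d⁆⁻ {b = b} {d} x∈ with x∈⁅y⁆∪p⁻ _ x∈
  ... | inj₁ x≡a = inj₁ x≡a
  ... | inj₂ x∈′ with x∈⁅y⁆∪p⁻ _ x∈′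
  ...   | inj₁ x≡b   = inj₂ (inj₁ x≡b)
  ...   | inj₂ x∈⁅d⁆ = inj₂ (inj₂ (x∈⁅y⁆⇒x≡y d x∈⁅d⁆))

  x∈⁅a·b·d⁆⁺ : ∀ {x a b d} → x ≡ a ⊎ x ≡ b ⊎ x ≡ d → x ∈ ⁅ a · b · d ⁆
  x∈⁅a·b·d⁆⁺     (inj₁ x≡a)         = x∈⁅y⁆∪p⁺ (inj₁ x≡a)
  x∈⁅a·b·d⁆⁺     (inj₂ (inj₁ x≡b))  = x∈⁅y⁆∪p⁺ (inj₂ (x∈⁅y⁆∪p⁺ (inj₁ x≡b)))
  x∈⁅a·b·d⁆⁺ {x} (inj₂ (inj₂ refl)) = x∈⁅y⁆∪p⁺ (inj₂ (x∈⁅y⁆∪p⁺ (inj₂ (x∈⁅x⁆ x))))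

x∉p-x : ∀ {n} (p : Subset n) x → x ∉ p - x
x∉p-x (_ ∷ p) zero    ()
x∉p-x (_ ∷ p) (suc x) (there x∈) = x∉p-x p x x∈

x∈p-y⇒x≢y : ∀ {n} {p : Subset n} {x y} → x ∈ p - y → x ≢ y
x∈p-y⇒x≢y {p = p} x∈ refl = x∉p-x p _ x∈

x∈p⇒∣p∣≡suc∣p-x∣ : ∀ {n} {p : Subset n} {x} → x ∈ p → ∣ p ∣ ≡ suc ∣ p - x ∣
x∈p⇒∣p∣≡suc∣p-x∣ {p = inside  ∷ p} here       = cong (suc ∘ ∣_∣) (sym (p─⊥≡p p))
x∈p⇒∣p∣≡suc∣p-x∣ {p = inside  ∷ p} (there x∈) = cong suc (x∈p⇒∣p∣≡suc∣p-x∣ x∈)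
x∈p⇒∣p∣≡suc∣p-x∣ {p = outside ∷ p} (there x∈) = x∈p⇒∣p∣≡suc∣p-x∣ x∈

∣p-x∣≡pred∣p∣ : ∀ {n} {p : Subset n} {x k} → ∣ p ∣ ≡ suc k → x ∈ p → ∣ p - x ∣ ≡ k
∣p-x∣≡pred∣p∣ ∣p∣≡1+k x∈ = suc-injective (trans (sym (x∈p⇒∣p∣≡suc∣p-x∣ x∈)) ∣p∣≡1+k)

∣p∣≡suc⇒Nonempty : ∀ {n} (p : Subset n) {k} → ∣ p ∣ ≡ suc k → Nonempty p
∣p∣≡suc⇒Nonempty (inside  ∷ p) _ = zero , here
∣p∣≡suc⇒Nonempty (outside ∷ p) ∣p∣≡1+k with ∣p∣≡suc⇒Nonempty p ∣p∣≡1+k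
... | x , x∈ = suc x , there x∈

∣p∣≡0⇒x∉p : ∀ {n} {p : Subset n} {x} → ∣ p ∣ ≡ 0 → x ∉ p
∣p∣≡0⇒x∉p ∣p∣≡0 x∈ with () ← trans (sym ∣p∣≡0) (x∈p⇒∣p∣≡suc∣p-x∣ x∈)

∣p∣≡3⇒∃Distinct₃ : ∀ {n} {p : Subset n} → ∣ p ∣ ≡ 3 →
  ∃[ a ] ∃[ b ] ∃[ d ] Distinct₃ a b d × a ∈ p × b ∈ p × d ∈ p
∣p∣≡3⇒∃Distinct₃ {p = p} ∣p∣≡3
  with a , a∈  ← ∣p∣≡suc⇒Nonempty p ∣p∣≡3
  with b , b∈₁ ← ∣p∣≡suc⇒Nonempty (p - a) (∣p-x∣≡pred∣p∣ ∣p∣≡3 a∈)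
  with d , d∈₂ ← ∣p∣≡suc⇒Nonempty (p - a - b) (∣p-x∣≡pred∣p∣ (∣p-x∣≡pred∣p∣ ∣p∣≡3 a∈) b∈₁)
  = a , b , d , (x∈p-y⇒x≢y b∈₁ ∘ sym , x∈p-y⇒x≢y d∈₁ ∘ sym , x∈p-y⇒x≢y d∈₂ ∘ sym)
  , a∈ , p─q⊆p p _ b∈₁ , p─q⊆p p _ d∈₁
  where
  d∈₁ : d ∈ p - a
  d∈₁ = p─q⊆p (p - a) _ d∈₂

∣p∣≡3⇒p≡⁅a·b·d⁆ : ∀ {n} {p : Subset n} {a b d} → ∣ p ∣ ≡ 3 → Distinct₃ a b d →
  a ∈ p → b ∈ p → d ∈ p → p ≡ ⁅ a · b · d ⁆
∣p∣≡3⇒p≡⁅a·b·d⁆ {p = p} {a} {b} {d} ∣p∣≡3 (a≢b , a≢d , b≢d) a∈ b∈ d∈ =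
  ⊆-antisym p⊆ ⊆p
  where
  ⊆p : ⁅ a · b · d ⁆ ⊆ p
  ⊆p x∈ = [ (λ { refl → a∈ }) , [ (λ { refl → b∈ }) , (λ { refl → d∈ }) ] ] (x∈⁅a·b·d⁆⁻ x∈)
  ∣p-a-b-d∣≡0 : ∣ p - a - b - d ∣ ≡ 0
  ∣p-a-b-d∣≡0 =
    ∣p-x∣≡pred∣p∣ (∣p-x∣≡pred∣p∣ (∣p-x∣≡pred∣p∣ ∣p∣≡3 a∈)
      (x∈p∧x≢y⇒x∈p-y b∈ (a≢b ∘ sym)))
      (x∈p∧x≢y⇒x∈p-y (x∈p∧x≢y⇒x∈p-y d∈ (a≢d ∘ sym)) (b≢d ∘ sym))
  p⊆ : p ⊆ ⁅ a · b · d ⁆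
  p⊆ {x} x∈ with x ≟ a | x ≟ b | x ≟ d
  ... | yes x≡a | _       | _       = x∈⁅a·b·d⁆⁺ (inj₁ x≡a)
  ... | no _    | yes x≡b | _       = x∈⁅a·b·d⁆⁺ (inj₂ (inj₁ x≡b))
  ... | no _    | no _    | yes x≡d = x∈⁅a·b·d⁆⁺ (inj₂ (inj₂ x≡d))
  ... | no x≢a  | no x≢b  | no x≢d  = ⊥-elim (∣p∣≡0⇒x∉p ∣p-a-b-d∣≡0
          (x∈p∧x≢y⇒x∈p-y (x∈p∧x≢y⇒x∈p-y (x∈p∧x≢y⇒x∈p-y x∈ x≢a) x≢b) x≢d))

module _ {n : ℕ} (G : Graph n) where

  T-adj-sym : ∀ {u v} → T (adj G u v) → T (adj G v u)
  T-adj-sym {u} {v} = subst T (adj-sym G u v)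

  T-adj⇒≢ : ∀ {u v} → T (adj G u v) → u ≢ v
  T-adj⇒≢ {u} uv refl with () ← trans (sym (Equivalence.to T-≡ uv)) (irrefl G u)

  ∈N⇒T-adj : ∀ {c x} → x ∈ N G c → T (adj G c x)
  ∈N⇒T-adj {c} {x} x∈ = Equivalence.from T-≡ (trans (sym (lookup∘tabulate (adj G c) x)) ([]=⇒lookup x∈))

  T-adj⇒∈N : ∀ {c x} → T (adj G c x) → x ∈ N G c
  T-adj⇒∈N {c} {x} cx = lookup⇒[]= x (N G c) (trans (lookup∘tabulate (adj G c) x) (Equivalence.to T-≡ cx))

  N[_] : Fin n → Subset n
  N[ c ] = ⁅ c ⁆ ∪ N G c

  x∈N[c]⁻ : ∀ {c x} → x ∈ N[ c ] → x ≡ c ⊎ T (adj G c x)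
  x∈N[c]⁻ x∈ = map₂ ∈N⇒T-adj (x∈⁅y⁆∪p⁻ _ x∈)

  x∈N[c]⁺ : ∀ {c x} → x ≡ c ⊎ T (adj G c x) → x ∈ N[ c ]
  x∈N[c]⁺ = x∈⁅y⁆∪p⁺ ∘ map₂ T-adj⇒∈N

  claw≡N[centre] : ∀ {S} (isClaw : IsClaw G S) → degree G (proj₁ isClaw) ≡ 3 → S ≡ N[ proj₁ isClaw ]
  claw≡N[centre] (c , a , b , d , S≡ , a≢b , a≢d , b≢d , ca , cb , cd , _) deg =
    trans S≡ (cong (⁅ c ⁆ ∪_) (sym (∣p∣≡3⇒p≡⁅a·b·d⁆ deg (a≢b , a≢d , b≢d)
      (leaf∈N ca) (leaf∈N cb) (leaf∈N cd))))
    where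
    leaf∈N : ∀ {x} → adj G c x ≡ true → x ∈ N G c
    leaf∈N = T-adj⇒∈N ∘ Equivalence.from T-≡

  module _ (triangleFree : TriangleFree G) where

    N[c]-isClaw : ∀ {c} → degree G c ≡ 3 → IsClaw G N[ c ]
    N[c]-isClaw {c} deg with a , b , d , (a≢b , a≢d , b≢d) , a∈ , b∈ , d∈ ← ∣p∣≡3⇒∃Distinct₃ deg =
      c , a , b , d , cong (⁅ c ⁆ ∪_) (∣p∣≡3⇒p≡⁅a·b·d⁆ deg (a≢b , a≢d , b≢d) a∈ b∈ d∈)
      , a≢b , a≢d , b≢d , centre-adj a∈ , centre-adj b∈ , centre-adj d∈
      , leaves-nonadj a∈ b∈ , leaves-nonadj a∈ d∈ , leaves-nonadj b∈ d∈
      where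
      centre-adj : ∀ {x} → x ∈ N G c → adj G c x ≡ true
      centre-adj = Equivalence.to T-≡ ∘ ∈N⇒T-adj
      leaves-nonadj : ∀ {x y} → x ∈ N G c → y ∈ N G c → adj G x y ≡ false
      leaves-nonadj x∈ y∈ = ¬-not λ xy →
        triangleFree c _ _ (∈N⇒T-adj x∈) (Equivalence.from T-≡ xy) (∈N⇒T-adj y∈)

    -- The degree hypothesis excludes an isolated edge cc′, for which N[c] = N[c′].
    N[c]-injective : ∀ {c c′} → degree G c ≡ 3 → N[ c ] ≡ N[ c′ ] → c ≡ c′
    N[c]-injective {c} {c′} deg N[c]≡N[c′] with c ≟ c′
    ... | yes c≡c′ = c≡c′
    ... | no c≢c′
      with a , b , _ , (a≢b , _) , a∈ , b∈ , _ ← ∣p∣≡3⇒∃Distinct₃ deg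
      = ⊥-elim (a≢b (trans (neighbour≡c′ (∈N⇒T-adj a∈)) (sym (neighbour≡c′ (∈N⇒T-adj b∈)))))
      where
      cc′ : T (adj G c c′)
      cc′ with x∈N[c]⁻ (subst (c′ ∈_) (sym N[c]≡N[c′]) (x∈N[c]⁺ (inj₁ refl)))
      ... | inj₁ c′≡c = ⊥-elim (c≢c′ (sym c′≡c))
      ... | inj₂ cc′  = cc′
      neighbour≡c′ : ∀ {x} → T (adj G c x) → x ≡ c′
      neighbour≡c′ {x} cx with x∈N[c]⁻ (subst (x ∈_) N[c]≡N[c′] (x∈N[c]⁺ (inj₂ cx)))
      ... | inj₁ x≡c′ = x≡c′
      ... | inj₂ c′x  = ⊥-elim (triangleFree c c′ x cc′ c′x cx)

    edge-in-N[c]-meets-c : ∀ {c u v} → u ∈ N[ c ] → v ∈ N[ c ] → T (adj G u v) → u ≡ c ⊎ v ≡ c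
    edge-in-N[c]-meets-c {c} {u} {v} u∈ v∈ uv with x∈N[c]⁻ u∈ | x∈N[c]⁻ v∈
    ... | inj₁ u≡c | _        = inj₁ u≡c
    ... | inj₂ _   | inj₁ v≡c = inj₂ v≡c
    ... | inj₂ cu  | inj₂ cv  = ⊥-elim (triangleFree c u v cu uv cv)

  claw-ext : ∀ {x y : Claw G} → verts x ≡ verts y → x ≡ y
  claw-ext refl = refl

  module _ (cubic : Cubic G) where

    -- A claw stores its structure irrelevantly, so the centre cannot be projected
    -- out of it; it is recomputed by a search whose success the structure certifies.
    centreOf : (x : Claw G) → ∃[ c ] verts x ≡ N[ c ]
    centreOf (claw S isClaw) = recompute (any? λ c → ≡-dec _≟ᵇ_ S N[ c ])
      (proj₁ isClaw , claw≡N[centre] isClaw (cubic (proj₁ isClaw)))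

    centre : Claw G → Fin n
    centre = proj₁ ∘ centreOf

    verts≡N[centre] : ∀ x → verts x ≡ N[ centre x ]
    verts≡N[centre] = proj₂ ∘ centreOf

    centre-injective : Injective _≡_ _≡_ centre
    centre-injective {x} {y} cx≡cy =
      claw-ext (trans (verts≡N[centre] x) (trans (cong N[_] cx≡cy) (sym (verts≡N[centre] y))))

    module _ (triangleFree : TriangleFree G) where

      centre-surjective : Surjective _≡_ _≡_ centre
      centre-surjective c =
        x , λ { refl → sym (N[c]-injective triangleFree (cubic c) (verts≡N[centre] x)) }
        where
        x : Claw G
        x = claw N[ c ] (N[c]-isClaw triangleFree (cubic c))

      edge-in-claw-meets-centre : ∀ x {u v} → EdgeIn G u v x → u ≡ centre x ⊎ v ≡ centre x
      edge-in-claw-meets-centre x {u} {v} (uv , u∈ , v∈) = edge-in-N[c]-meets-c triangleFree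
        (subst (u ∈_) (verts≡N[centre] x) u∈) (subst (v ∈_) (verts≡N[centre] x) v∈) uv

      v∈verts⁺ : ∀ x {v} → v ≡ centre x ⊎ T (adj G (centre x) v) → v ∈ verts x
      v∈verts⁺ x {v} = subst (v ∈_) (sym (verts≡N[centre] x)) ∘ x∈N[c]⁺

      ClAdj⇔adj-centre : ∀ x y → ClAdj G x y ⇔ T (adj G (centre x) (centre y))
      ClAdj⇔adj-centre x y = mk⇔ to from
        where
        to : ClAdj G x y → T (adj G (centre x) (centre y))
        to (x≢y , u , v , uv∈x@(uv , _) , uv∈y)
          with edge-in-claw-meets-centre x uv∈x | edge-in-claw-meets-centre y uv∈y
        ... | inj₁ refl | inj₁ eq   = ⊥-elim (x≢y (centre-injective eq))
        ... | inj₁ refl | inj₂ refl = uv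
        ... | inj₂ refl | inj₁ refl = T-adj-sym uv
        ... | inj₂ refl | inj₂ eq   = ⊥-elim (x≢y (centre-injective eq))
        from : T (adj G (centre x) (centre y)) → ClAdj G x y
        from xy = T-adj⇒≢ xy ∘ cong centre , centre x , centre y
          , (xy , v∈verts⁺ x (inj₁ refl) , v∈verts⁺ x (inj₂ xy))
          , (xy , v∈verts⁺ y (inj₂ (T-adj-sym xy)) , v∈verts⁺ y (inj₁ refl))

theorem3 : ∀ (n : ℕ) (G : Graph n) → TriangleFree G → Cubic G → ClawGraphIsoToG G
theorem3 n G triangleFree cubic =
  mk⤖ (centre-injective G cubic , centre-surjective G cubic triangleFree)
  , ClAdj⇔adj-centre G cubic triangleFree
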